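{- If $G$ is a complete $k$-partite graph (with $k \ge 1$), then $\varphi(G)=\min\{m : k\le S(1,m)\}$.
   Context: Two sets overlap if they intersect and neither is a subset of the other. An overlap representation of a graph $G=(V,E)$ is a family (multiset) of sets $\{S_v : v\in V\}$ such that for all $u,v\in V$, $(u,v)\in E$ iff $S_u\cap S_v\neq\emptyset$, $S_u\not\subseteq S_v$ and $S_v\not\subseteq S_u$; its size is $|\bigcup_{v} S_v|$, and the overlap number $\varphi(G)$ is the minimum size of an overlap representation of $G$. For integers $m\ge 1$, $p\ge 0$, $S(p,m)$ denotes the maximum size of a family $\mathcal{C}$ of subsets of $\{1,\dots,m\}$ such that for distinct $A,B\in\mathcal{C}$, $A\not\subseteq B$, and for all $A,B\in\mathcal{C}$, $|A\cap B|\ge p$. -}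

module Defs where

open import Data.Nat using (ℕ; _≤_)
open import Data.Fin using (Fin)
open import Data.Fin.Subset using (Subset; _⊆_; _∩_; ⋃; ∣_∣; Nonempty)
open import Data.List using (List; tabulate)
open import Data.Product using (Σ; _×_; ∃)
open import Function.Bundles using (_⇔_)
open import Relation.Nullary using (¬_)
open import Relation.Binary.PropositionalEquality using (_≡_; _≢_)

Overlap : ∀ {N} → Subset N → Subset N → Set
Overlap A B = Nonempty (A ∩ B) × (¬ (A ⊆ B)) × (¬ (B ⊆ A))

Graph : ℕ → Set₁
Graph n = Fin n → Fin n → Set

⋃fam : ∀ {n N} → (Fin n → Subset N) → Subset N
⋃fam S = ⋃ (tabulate S)

IsOverlapRep : ∀ {n N} → Graph n → (Fin n → Subset N) → Set
IsOverlapRep G S =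
  (∀ v → Nonempty (S v)) × (∀ u v → G u v ⇔ Overlap (S u) (S v))

IsOverlapNumber : ∀ {n} → Graph n → ℕ → Set
IsOverlapNumber {n} G m =
  (Σ ℕ λ N → Σ (Fin n → Subset N) λ S → IsOverlapRep G S × ∣ ⋃fam S ∣ ≡ m)
  × (∀ N (S : Fin n → Subset N) → IsOverlapRep G S → m ≤ ∣ ⋃fam S ∣)

-- A family C = {C 0,…,C (t-1)} of t distinct subsets of {1..m} (= Fin m) that is an
-- antichain (distinct members incomparable, hence distinct) with all pairwise
-- (including A = B) intersections of size ≥ p.
IsSFamily : (p m t : ℕ) → (Fin t → Subset m) → Set
IsSFamily p m t C =
  (∀ i j → i ≢ j → ¬ (C i ⊆ C j)) × (∀ i j → p ≤ ∣ C i ∩ C j ∣)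

IsS : (p m s : ℕ) → Set
IsS p m s =
  (Σ (Fin s → Subset m) λ C → IsSFamily p m s C)
  × (∀ t (C : Fin t → Subset m) → IsSFamily p m t C → t ≤ s)

CompleteMultipartite : ∀ {n k} → (Fin n → Fin k) → Graph n
CompleteMultipartite part u v = part u ≢ part v

Surjective : ∀ {n k} → (Fin n → Fin k) → Set
Surjective {n} {k} f = ∀ (y : Fin k) → ∃ λ x → f x ≡ y

IsLeast : (ℕ → Set) → ℕ → Set
IsLeast P m = P m × (∀ m' → P m' → m ≤ m')

-- Choosing one vertex in each of the k parts therefore turns any overlap
-- representation into k nonempty, pairwise overlapping sets inside its union U, and
-- relabelling U as Fin ∣U∣ keeps them so. Conversely, k such sets in Fin m represent the
-- graph when every vertex receives the set of its part. Hence φ(G) is the least m for which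
-- Fin m carries k nonempty pairwise overlapping sets, and these are exactly the intersecting
-- antichains counted by S(1,m). All conditions involved are decidable, so the minimum and
-- S(1,m) (bounded by 2 ^ m) exist constructively.
module Submission where

open import Defs
open import Data.Nat using (ℕ; _≤_)
open import Data.Fin using (Fin)
open import Data.Product using (Σ; _×_)

open import Data.Nat using (zero; suc; _<_; _^_; z≤n; s≤s)
open import Data.Nat.Properties
  using (≤-pred; n≤0⇒n≡0; ≮⇒≥; ≤∧≢⇒<; m≤n⇒m<n∨m≡n; ≤-refl; ≤-trans; ≤-antisym)
open import Data.Fin as F using (inject≤; funToFin; finToFun)
open import Data.Fin.Properties
  using (toℕ<n; 2↔Bool; finToFun-funToFin; injective⇒≤; inject≤-injective; all?; ¬∀⟶∃¬)
  renaming (_≟_ to _≟ᶠ_)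
open import Data.Fin.Subset
open import Data.Fin.Subset.Properties
open import Data.Vec using ([]; _∷_; lookup; tabulate)
open import Data.Vec.Properties using (tabulate∘lookup; tabulate-cong)
open import Data.Vec.Functional using (head; tail) renaming (_∷_ to _∷ᶠ_)
open import Data.Vec.Functional.Properties using (∷-cong)
open import Data.Vec.Base using (here; there)
open import Data.Product using (_,_; proj₁; proj₂; ∃)
open import Data.Sum using (inj₁; inj₂; _⊎_)
open import Function using (_∘_)
open import Function.Bundles using (_⇔_; mk⇔; Equivalence; Inverse)
open import Function.Definitions using (Injective)
open import Relation.Nullary using (¬_; Dec; yes; no; contradiction)
open import Relation.Nullary.Decidable using (_×-dec_; _→-dec_; ¬?)
open import Relation.Unary using (Decidable)
open import Relation.Binary.Definitions using (_Respects_)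
open import Relation.Binary.PropositionalEquality
  using (_≡_; _≢_; _≗_; refl; sym; trans; cong; subst; subst₂; module ≡-Reasoning)

IsGreatest : (ℕ → Set) → ℕ → Set
IsGreatest P m = P m × (∀ m' → P m' → m' ≤ m)

IsLeast-cong : ∀ {P Q : ℕ → Set} {m} → (∀ m' → P m' ⇔ Q m') → IsLeast P m → IsLeast Q m
IsLeast-cong P⇔Q (pm , least) =
  Equivalence.to (P⇔Q _) pm , λ m' qm' → least m' (Equivalence.from (P⇔Q m') qm')

module _ {P : ℕ → Set} (P? : Decidable P) where

  least-upTo : ∀ b → (∀ m → m ≤ b → ¬ P m) ⊎ ∃ (IsLeast P)
  least-upTo zero with P? zero
  ... | yes p0 = inj₂ (zero , p0 , λ _ _ → z≤n)
  ... | no ¬p0 = inj₁ λ m m≤0 → subst (¬_ ∘ P) (sym (n≤0⇒n≡0 m≤0)) ¬p0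
  least-upTo (suc b) with least-upTo b
  ... | inj₂ least = inj₂ least
  ... | inj₁ none with P? (suc b)
  ...   | yes pb = inj₂ (suc b , pb , λ m pm → ≮⇒≥ λ m<1+b → none m (≤-pred m<1+b) pm)
  ...   | no ¬pb = inj₁ λ m m≤1+b → below-or-equal m (m≤n⇒m<n∨m≡n m≤1+b)
    where
    below-or-equal : ∀ m → m < suc b ⊎ m ≡ suc b → ¬ P m
    below-or-equal m (inj₁ m<1+b) = none m (≤-pred m<1+b)
    below-or-equal m (inj₂ refl) = ¬pb

  least-exists : ∀ {b} → P b → ∃ (IsLeast P)
  least-exists {b} pb with least-upTo b
  ... | inj₁ none = contradiction pb (none b ≤-refl)
  ... | inj₂ least = least

  greatest-exists : ∀ b → (∀ m → P m → m ≤ b) → ∀ {m} → P m → ∃ (IsGreatest P)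
  greatest-exists b bounded pm with P? b
  ... | yes pb = b , pb , bounded
  greatest-exists zero bounded pm | no ¬p0 =
    contradiction (subst P (n≤0⇒n≡0 (bounded _ pm)) pm) ¬p0
  greatest-exists (suc b) bounded pm | no ¬pb =
    greatest-exists b (λ m pm′ → ≤-pred (≤∧≢⇒< (bounded m pm′) λ { refl → ¬pb pm′ })) pm

nonempty⇒0<∣p∣ : ∀ {n} {p : Subset n} → Nonempty p → 0 < ∣ p ∣
nonempty⇒0<∣p∣ (x , x∈p) = ≤-trans (s≤s z≤n) (x∈p⇒∣p-x∣<∣p∣ x∈p)

0<∣p∣⇒nonempty : ∀ {n} {p : Subset n} → 0 < ∣ p ∣ → Nonempty p
0<∣p∣⇒nonempty {n} {p} 0<∣p∣ with nonempty? p
... | yes nonempty = nonempty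
... | no empty with () ← subst (0 <_) (trans (cong ∣_∣ (Empty-unique empty)) (∣⊥∣≡0 n)) 0<∣p∣

⊈⇒∃∉ : ∀ {n} {p q : Subset n} → ¬ p ⊆ q → ∃ λ x → x ∈ p × x ∉ q
⊈⇒∃∉ {n} {p} {q} p⊈q
  with ¬∀⟶∃¬ n (λ x → x ∈ p → x ∈ q) (λ x → (x ∈? p) →-dec (x ∈? q)) (λ p⊆q → p⊈q (p⊆q _))
... | x , ¬[x∈p→x∈q] with x ∈? p
...   | yes x∈p = x , x∈p , λ x∈q → ¬[x∈p→x∈q] λ _ → x∈q
...   | no x∉p = contradiction (λ x∈p → contradiction x∈p x∉p) ¬[x∈p→x∈q]

encode : ∀ {m} → Subset m → Fin (2 ^ m)
encode p = funToFin (Inverse.from 2↔Bool ∘ lookup p)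

encode-injective : ∀ {m} → Injective _≡_ _≡_ (encode {m})
encode-injective {x = p} {q} encode-p≡encode-q = begin
  p                   ≡⟨ sym (tabulate∘lookup p) ⟩
  tabulate (lookup p) ≡⟨ tabulate-cong lookup-p≗lookup-q ⟩
  tabulate (lookup q) ≡⟨ tabulate∘lookup q ⟩
  q                   ∎
  where
  open ≡-Reasoning
  open Inverse 2↔Bool using (to; from; strictlyInverseˡ)
  lookup-p≗lookup-q : lookup p ≗ lookup q
  lookup-p≗lookup-q i = begin
    lookup p i                 ≡⟨ sym (strictlyInverseˡ (lookup p i)) ⟩
    to (from (lookup p i))     ≡⟨ cong to (sym (finToFun-funToFin (from ∘ lookup p) i)) ⟩
    to (finToFun (encode p) i) ≡⟨ cong (λ c → to (finToFun c i)) encode-p≡encode-q ⟩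
    to (finToFun (encode q) i) ≡⟨ cong to (finToFun-funToFin (from ∘ lookup q) i) ⟩
    to (from (lookup q i))     ≡⟨ strictlyInverseˡ (lookup q i) ⟩
    lookup q i                 ∎

restrict : ∀ {N} (U : Subset N) → Subset N → Subset ∣ U ∣
restrict [] [] = []
restrict (inside ∷ U) (a ∷ A) = a ∷ restrict U A
restrict (outside ∷ U) (a ∷ A) = restrict U A

index : ∀ {N} {U : Subset N} {x} → x ∈ U → Fin ∣ U ∣
index {U = inside ∷ U} here = F.zero
index {U = inside ∷ U} (there x∈U) = F.suc (index x∈U)
index {U = outside ∷ U} (there x∈U) = index x∈U

∈-restrict⁺ : ∀ {N} {U A : Subset N} {x} (x∈U : x ∈ U) → x ∈ A → index x∈U ∈ restrict U A
∈-restrict⁺ {U = inside ∷ U} {a ∷ A} here here = here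
∈-restrict⁺ {U = inside ∷ U} {a ∷ A} (there x∈U) (there x∈A) = there (∈-restrict⁺ x∈U x∈A)
∈-restrict⁺ {U = outside ∷ U} {a ∷ A} (there x∈U) (there x∈A) = ∈-restrict⁺ x∈U x∈A

∈-restrict⁻ : ∀ {N} {U A : Subset N} {x} (x∈U : x ∈ U) → index x∈U ∈ restrict U A → x ∈ A
∈-restrict⁻ {U = inside ∷ U} {a ∷ A} here here = here
∈-restrict⁻ {U = inside ∷ U} {a ∷ A} (there x∈U) (there i∈A) = there (∈-restrict⁻ x∈U i∈A)
∈-restrict⁻ {U = outside ∷ U} {a ∷ A} (there x∈U) i∈A = there (∈-restrict⁻ x∈U i∈A)

restrict-nonempty∩ : ∀ {N} {U A B : Subset N} → A ⊆ U →
  Nonempty (A ∩ B) → Nonempty (restrict U A ∩ restrict U B)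
restrict-nonempty∩ {A = A} {B} A⊆U (x , x∈A∩B) =
  let x∈A , x∈B = x∈p∩q⁻ A B x∈A∩B
  in  index (A⊆U x∈A) , x∈p∩q⁺ (∈-restrict⁺ (A⊆U x∈A) x∈A , ∈-restrict⁺ (A⊆U x∈A) x∈B)

restrict-⊈ : ∀ {N} {U A B : Subset N} → A ⊆ U → ¬ A ⊆ B → ¬ restrict U A ⊆ restrict U B
restrict-⊈ A⊆U A⊈B rA⊆rB =
  let x , x∈A , x∉B = ⊈⇒∃∉ A⊈B
  in  x∉B (∈-restrict⁻ (A⊆U x∈A) (rA⊆rB (∈-restrict⁺ (A⊆U x∈A) x∈A)))

restrict-overlap : ∀ {N} {U A B : Subset N} → A ⊆ U → B ⊆ U →
  Overlap A B → Overlap (restrict U A) (restrict U B)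
restrict-overlap A⊆U B⊆U (A∩B≢∅ , A⊈B , B⊈A) =
  restrict-nonempty∩ A⊆U A∩B≢∅ , restrict-⊈ A⊆U A⊈B , restrict-⊈ B⊆U B⊈A

⊆-⋃fam : ∀ {n N} (S : Fin n → Subset N) v → S v ⊆ ⋃fam S
⊆-⋃fam S F.zero x∈Sv = p⊆p∪q _ x∈Sv
⊆-⋃fam S (F.suc v) x∈Sv = q⊆p∪q (S F.zero) _ (⊆-⋃fam (S ∘ F.suc) v x∈Sv)

-- The hypothesis on P stands in for function extensionality: x ∷ᶠ g is only pointwise
-- equal to a family f with head f ≡ x and tail f ≗ g.
module _ {A : Set} (∃? : ∀ {Q : A → Set} → Decidable Q → Dec (∃ Q)) where

  ∃-family? : ∀ t {P : (Fin t → A) → Set} → P Respects _≗_ → Decidable P → Dec (∃ P)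
  ∃-family? zero P-resp P? with P? (λ ())
  ... | yes p = yes (_ , p)
  ... | no ¬p = no λ (f , pf) → ¬p (P-resp (λ ()) pf)
  ∃-family? (suc t) {P} P-resp P?
    with ∃? (λ x → ∃-family? t {P ∘ (x ∷ᶠ_)} (P-resp ∘ ∷-cong refl) (P? ∘ (x ∷ᶠ_)))
  ... | yes (x , g , p) = yes (x ∷ᶠ g , p)
  ... | no ¬p = no λ (f , pf) → ¬p (head f , tail f , P-resp (∷-cong refl λ _ → refl) pf)

OverlapFamily : ∀ {m} t → (Fin t → Subset m) → Set
OverlapFamily t C = (∀ i → Nonempty (C i)) × (∀ i j → i ≢ j → Overlap (C i) (C j))

HasOverlapFamily : ℕ → ℕ → Set
HasOverlapFamily t m = ∃ (OverlapFamily {m} t)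

overlap? : ∀ {m} (A B : Subset m) → Dec (Overlap A B)
overlap? A B = nonempty? (A ∩ B) ×-dec ¬? (A ⊆? B) ×-dec ¬? (B ⊆? A)

overlapFamily? : ∀ {m t} → Decidable (OverlapFamily {m} t)
overlapFamily? C = all? (nonempty? ∘ C)
  ×-dec all? λ i → all? λ j → ¬? (i ≟ᶠ j) →-dec overlap? (C i) (C j)

overlapFamily-respects-≗ : ∀ {m t} → OverlapFamily {m} t Respects _≗_
overlapFamily-respects-≗ {C} {D} C≗D (nonempty , overlapping) =
  (λ i → subst Nonempty (C≗D i) (nonempty i)) ,
  λ i j i≢j → subst₂ Overlap (C≗D i) (C≗D j) (overlapping i j i≢j)

hasOverlapFamily? : ∀ t m → Dec (HasOverlapFamily t m)
hasOverlapFamily? t m = ∃-family? anySubset? t overlapFamily-respects-≗ overlapFamily?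

overlapFamily-∘ : ∀ {m s t} {C : Fin t → Subset m} {f : Fin s → Fin t} →
  Injective _≡_ _≡_ f → OverlapFamily t C → OverlapFamily s (C ∘ f)
overlapFamily-∘ f-injective (nonempty , overlapping) =
  nonempty ∘ _ , λ i j i≢j → overlapping _ _ (i≢j ∘ f-injective)

overlapFamily-injective : ∀ {m t} {C : Fin t → Subset m} →
  OverlapFamily t C → Injective _≡_ _≡_ C
overlapFamily-injective (_ , overlapping) {i} {j} Ci≡Cj with i ≟ᶠ j
... | yes i≡j = i≡j
... | no i≢j =
  contradiction (λ {x} → ⊆-reflexive Ci≡Cj {x}) (proj₁ (proj₂ (overlapping i j i≢j)))

overlapFamily-size : ∀ {m t} {C : Fin t → Subset m} → OverlapFamily t C → t ≤ 2 ^ m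
overlapFamily-size family = injective⇒≤ (overlapFamily-injective family ∘ encode-injective)

hasOverlapFamily-restrict : ∀ {N t} (U : Subset N) {C : Fin t → Subset N} →
  (∀ i → C i ⊆ U) → OverlapFamily t C → HasOverlapFamily t ∣ U ∣
hasOverlapFamily-restrict U {C} C⊆U (nonempty , overlapping) =
  restrict U ∘ C ,
  (λ i → let x , x∈Ci = nonempty i in index (C⊆U i x∈Ci) , ∈-restrict⁺ (C⊆U i x∈Ci) x∈Ci) ,
  λ i j i≢j → restrict-overlap (C⊆U i) (C⊆U j) (overlapping i j i≢j)

IsSFamily⇒OverlapFamily : ∀ {m t} {C : Fin t → Subset m} →
  IsSFamily 1 m t C → OverlapFamily t C
IsSFamily⇒OverlapFamily {C = C} (antichain , intersecting) =
  (λ i → let x , x∈Ci∩Ci = 0<∣p∣⇒nonempty (intersecting i i)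
         in  x , proj₁ (x∈p∩q⁻ (C i) (C i) x∈Ci∩Ci)) ,
  λ i j i≢j → 0<∣p∣⇒nonempty (intersecting i j) , antichain i j i≢j , antichain j i (i≢j ∘ sym)

OverlapFamily⇒IsSFamily : ∀ {m t} {C : Fin t → Subset m} →
  OverlapFamily t C → IsSFamily 1 m t C
OverlapFamily⇒IsSFamily {C = C} (nonempty , overlapping) =
  (λ i j i≢j → proj₁ (proj₂ (overlapping i j i≢j))) , intersecting
  where
  intersecting : ∀ i j → 0 < ∣ C i ∩ C j ∣
  intersecting i j with i ≟ᶠ j
  ... | yes refl = let x , x∈Ci = nonempty i in nonempty⇒0<∣p∣ (x , x∈p∩q⁺ (x∈Ci , x∈Ci))
  ... | no i≢j = nonempty⇒0<∣p∣ (proj₁ (overlapping i j i≢j))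

pairsThroughZero : ∀ k → HasOverlapFamily k (suc k)
pairsThroughZero k = pair , (λ i → F.zero , zero∈pair i) , overlapping
  where
  pair : Fin k → Subset (suc k)
  pair i = ⁅ F.zero ⁆ ∪ ⁅ F.suc i ⁆
  zero∈pair : ∀ i → F.zero ∈ pair i
  zero∈pair i = x∈p∪q⁺ {p = ⁅ F.zero ⁆} {q = ⁅ F.suc i ⁆} (inj₁ (x∈⁅x⁆ F.zero))
  pair⊈pair : ∀ i j → i ≢ j → ¬ pair i ⊆ pair j
  pair⊈pair i j i≢j pair-i⊆pair-j
    with x∈p∪q⁻ ⁅ F.zero ⁆ _ (pair-i⊆pair-j (x∈p∪q⁺ (inj₂ (x∈⁅x⁆ (F.suc i)))))
  ... | inj₁ 1+i∈⁅0⁆ with () ← x∈⁅y⁆⇒x≡y F.zero 1+i∈⁅0⁆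
  ... | inj₂ 1+i∈⁅1+j⁆ with refl ← x∈⁅y⁆⇒x≡y (F.suc j) 1+i∈⁅1+j⁆ = i≢j refl
  overlapping : ∀ i j → i ≢ j → Overlap (pair i) (pair j)
  overlapping i j i≢j =
    (F.zero , x∈p∩q⁺ (zero∈pair i , zero∈pair j)) , pair⊈pair i j i≢j , pair⊈pair j i (i≢j ∘ sym)

S[1,m]-exists : ∀ {m t} → HasOverlapFamily t m → Σ ℕ λ s → IsS 1 m s × t ≤ s
S[1,m]-exists {m} {t} family
  with greatest-exists (λ u → hasOverlapFamily? u m) (2 ^ m)
         (λ _ → overlapFamily-size ∘ proj₂) family
... | s , (D , familyD) , maximal =
  s , ((D , OverlapFamily⇒IsSFamily familyD) ,
         λ u C isS → maximal u (C , IsSFamily⇒OverlapFamily isS)) ,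
  maximal t family

hasOverlapFamily⇔k≤S[1,m] : ∀ {k} → 1 ≤ k → ∀ m →
  HasOverlapFamily k m ⇔ (1 ≤ m × Σ ℕ λ s → IsS 1 m s × k ≤ s)
hasOverlapFamily⇔k≤S[1,m] (s≤s z≤n) _ = mk⇔
  (λ family@(_ , nonempty , _) →
    let x , _ = nonempty F.zero in ≤-trans (s≤s z≤n) (toℕ<n x) , S[1,m]-exists family)
  λ (_ , s , ((D , isS) , _) , k≤s) →
    D ∘ (λ i → inject≤ i k≤s) ,
    overlapFamily-∘ (λ {i} {j} → inject≤-injective k≤s k≤s i j) (IsSFamily⇒OverlapFamily isS)

overlapFamily⇒rep : ∀ {n k m} (part : Fin n → Fin k) {C : Fin k → Subset m} →
  OverlapFamily k C → IsOverlapRep (CompleteMultipartite part) (C ∘ part)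
overlapFamily⇒rep part {C} (nonempty , overlapping) =
  nonempty ∘ part ,
  λ u v → mk⇔ (overlapping (part u) (part v))
    λ (_ , Cu⊈Cv , _) part-u≡part-v → Cu⊈Cv (⊆-reflexive (cong C part-u≡part-v))

module _ {n k} (part : Fin n → Fin k) (surjective : Surjective part) where

  private
    representative : Fin k → Fin n
    representative i = proj₁ (surjective i)

    part∘representative : ∀ i → part (representative i) ≡ i
    part∘representative i = proj₂ (surjective i)

  rep⇒overlapFamily : ∀ {N} {S : Fin n → Subset N} →
    IsOverlapRep (CompleteMultipartite part) S → OverlapFamily k (S ∘ representative)
  rep⇒overlapFamily (nonempty , adjacent⇔overlap) =
    nonempty ∘ representative ,
    λ i j i≢j → Equivalence.to (adjacent⇔overlap _ _) λ same-part →
      i≢j (trans (sym (part∘representative i)) (trans same-part (part∘representative j)))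

  overlapNumber-completeMultipartite : ∀ {m} →
    IsLeast (HasOverlapFamily k) m → IsOverlapNumber (CompleteMultipartite part) m
  overlapNumber-completeMultipartite {m} ((C , family) , least) =
    (m , C ∘ part , overlapFamily⇒rep part family ,
      ≤-antisym (∣p∣≤n U) (least ∣ U ∣ (hasOverlapFamily-restrict U C⊆U family))) ,
    λ N S rep → least _ (hasOverlapFamily-restrict (⋃fam S) (⊆-⋃fam S ∘ representative)
                          (rep⇒overlapFamily rep))
    where
    U : Subset m
    U = ⋃fam (C ∘ part)
    C⊆U : ∀ i → C i ⊆ U
    C⊆U i {x} x∈Ci =
      ⊆-⋃fam (C ∘ part) (representative i)
        (subst (λ j → x ∈ C j) (sym (part∘representative i)) x∈Ci)

corollary10 : (n k : ℕ) → 1 ≤ k → (part : Fin n → Fin k) → Surjective part →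
    Σ ℕ λ φ → IsOverlapNumber (CompleteMultipartite part) φ
      × IsLeast (λ m → 1 ≤ m × (Σ ℕ λ s → IsS 1 m s × k ≤ s)) φ
corollary10 n k 1≤k part surjective =
  let m , least = least-exists (hasOverlapFamily? k) (pairsThroughZero k)
  in  m , overlapNumber-completeMultipartite part surjective least ,
      IsLeast-cong (hasOverlapFamily⇔k≤S[1,m] 1≤k) least
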